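{- Let $S_1,S_2\subseteq\mathbb{F}_2^n$ be powerful sets. Define $S_1\diamond S_2\subseteq\mathbb{F}_2^{n+3}$ as follows: let $A:=\{\mathbf{v}0\mid\mathbf{v}\in S_1\}\subseteq\mathbb{F}_2^{n+1}$ and $B:=\{\mathbf{0}_n0\}\cup\{\mathbf{v}1\mid \mathbf{v}\in S_2\setminus\{\mathbf{0}_n\}\}\subseteq\mathbb{F}_2^{n+1}$, and \[S_1\diamond S_2:=\{\mathbf{w}00\mid \mathbf{w}\in A\cap B\}\cup\{\mathbf{w}01\mid \mathbf{w}\in A\setminus B\}\cup\{\mathbf{w}10\mid \mathbf{w}\in B\setminus A\}\cup\{\mathbf{w}11\mid \mathbf{w}\in\mathbb{F}_2^{n+1}\setminus(A\cup B)\}.\] Then $S_1\diamond S_2$ is a powerful set.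
   Context: Juxtaposition denotes appending bits to a vector; $\mathbf{0}_n$ is the zero vector of length $n$. A set $S\subseteq\mathbb{F}_2^n$ (positions indexed by $[n]$) is a powerful set if for every $X\subseteq[n]$ the number of vectors in $S$ that are zero in all positions of $X$ is a power of $2$. -}

module Defs where

open import Data.Bool using (Bool; true; false; _∧_; _∨_; not; if_then_else_)
open import Data.Nat using (ℕ; zero; suc; _+_; _^_)
open import Data.List using (List; []; _∷_; _++_; map; filter; length)
open import Data.Vec using (Vec; []; _∷_; _∷ʳ_; splitAt)
open import Data.Product using (Σ; _,_)
open import Relation.Binary.PropositionalEquality using (_≡_; refl)
open import Relation.Nullary.Decidable using (Dec)
open import Data.Bool using (_≟_)

-- F₂ⁿ is modelled as Vec Bool n (false = 0, true = 1).
-- A subset S ⊆ F₂ⁿ is given by its (decidable) characteristic function.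
BSet : ℕ → Set
BSet n = Vec Bool n → Bool

allVecs : (n : ℕ) → List (Vec Bool n)
allVecs zero = [] ∷ []
allVecs (suc n) = map (false ∷_) (allVecs n) ++ map (true ∷_) (allVecs n)

-- zeroOn X v = true iff v is zero in every position of X (X ⊆ [n] as a Vec Bool n).
zeroOn : {n : ℕ} → Vec Bool n → Vec Bool n → Bool
zeroOn [] [] = true
zeroOn (true ∷ X) (b ∷ v) = not b ∧ zeroOn X v
zeroOn (false ∷ X) (b ∷ v) = zeroOn X v

countZeroOn : {n : ℕ} → BSet n → Vec Bool n → ℕ
countZeroOn {n} S X = length (filter (λ v → S v ∧ zeroOn X v ≟ true) (allVecs n))

IsPowerOfTwo : ℕ → Set
IsPowerOfTwo m = Σ ℕ (λ k → m ≡ 2 ^ k)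

Powerful : {n : ℕ} → BSet n → Set
Powerful {n} S = (X : Vec Bool n) → IsPowerOfTwo (countZeroOn S X)

isZeroVec : {n : ℕ} → Vec Bool n → Bool
isZeroVec [] = true
isZeroVec (b ∷ v) = not b ∧ isZeroVec v

-- Elements of F₂^{n+1} are written w = v c with v ∈ F₂ⁿ, c ∈ F₂.
-- inA S₁ v c  ⇔  v c ∈ A = { v0 | v ∈ S₁ }
inA : {n : ℕ} → BSet n → Vec Bool n → Bool → Bool
inA S₁ v false = S₁ v
inA S₁ v true  = false

inB : {n : ℕ} → BSet n → Vec Bool n → Bool → Bool
inB S₂ v false = isZeroVec v
inB S₂ v true  = S₂ v ∧ not (isZeroVec v)

diamondAux : {n : ℕ} → BSet n → BSet n → Vec Bool n → Vec Bool 3 → Bool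
diamondAux S₁ S₂ v (c ∷ b₁ ∷ b₂ ∷ []) =
     (a ∧ b ∧ not b₁ ∧ not b₂)
  ∨ (a ∧ not b ∧ not b₁ ∧ b₂)
  ∨ (not a ∧ b ∧ b₁ ∧ not b₂)
  ∨ (not a ∧ not b ∧ b₁ ∧ b₂)
  where
    a = inA S₁ v c
    b = inB S₂ v c

_◇_ : {n : ℕ} → BSet n → BSet n → BSet (n + 3)
_◇_ {n} S₁ S₂ u with splitAt n u
... | v , t , _ = diamondAux S₁ S₂ v t

-- Above each w ∈ F₂^{n+1} the set S₁ ◇ S₂ has exactly one point, w [w ∉ A] [w ∉ B].  Hence for
-- X = X′ z₁ z₂ the count of S₁ ◇ S₂ on X is the count on X′ of A ∩ B, A, B or all of F₂^{n+1},
-- according to which of z₁, z₂ are marked, and each of these four sets is powerful.  A has the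
-- counts of S₁.  Marking all coordinates shows that a powerful set contains 0, so A ∩ B = {0ₙ0},
-- and B has count 1 when its last coordinate is marked and 1 + (count of S₂ − 1) otherwise.
module Submission where

open import Defs
open import Algebra.Properties.CommutativeSemigroup as CommSemigroupProperties using ()
open import Data.Bool using (Bool; true; false; _∧_; not; _≟_)
open import Data.Bool.Properties using (∧-assoc; ∧-comm; ∧-zeroʳ; ∧-identityʳ)
open import Data.List using (List; []; _∷_; map; filter; length) renaming (_++_ to _++ₗ_)
import Data.List.Properties as Listₚ
open import Data.Nat using (ℕ; zero; suc; _+_; _^_)
open import Data.Nat.Properties using (+-identityʳ; +-commutativeSemigroup; m^n≡0⇒m≡0)
open import Data.Product using (_,_)
open import Data.Vec using (Vec; []; _∷_; _++_; splitAt; replicate)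
open import Function using (_∘_)
open import Relation.Binary.PropositionalEquality
open import Relation.Nullary.Decidable using (Dec)
open ≡-Reasoning

open CommSemigroupProperties +-commutativeSemigroup using (interchange)

ind : Bool → ℕ
ind true  = 1
ind false = 0

zeros : (n : ℕ) → Vec Bool n
zeros n = replicate n false

sumVecs : {n : ℕ} → (Vec Bool n → ℕ) → ℕ
sumVecs {zero}  h = h []
sumVecs {suc n} h = sumVecs (h ∘ (false ∷_)) + sumVecs (h ∘ (true ∷_))

sumVecs-cong : {n : ℕ} {f g : Vec Bool n → ℕ} → (∀ v → f v ≡ g v) → sumVecs f ≡ sumVecs g
sumVecs-cong {zero}  f≡g = f≡g []
sumVecs-cong {suc n} f≡g =
  cong₂ _+_ (sumVecs-cong (f≡g ∘ (false ∷_))) (sumVecs-cong (f≡g ∘ (true ∷_)))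

sumVecs-0 : (n : ℕ) → sumVecs {n} (λ _ → 0) ≡ 0
sumVecs-0 zero    = refl
sumVecs-0 (suc n) = cong₂ _+_ (sumVecs-0 n) (sumVecs-0 n)

sumVecs-+ : {n : ℕ} (f g : Vec Bool n → ℕ) →
            sumVecs (λ v → f v + g v) ≡ sumVecs f + sumVecs g
sumVecs-+ {zero}  f g = refl
sumVecs-+ {suc n} f g = begin
  sumVecs (λ v → f (false ∷ v) + g (false ∷ v)) + sumVecs (λ v → f (true ∷ v) + g (true ∷ v))
    ≡⟨ cong₂ _+_ (sumVecs-+ {n} _ _) (sumVecs-+ {n} _ _) ⟩
  (sumVecs {n} (f ∘ (false ∷_)) + sumVecs {n} (g ∘ (false ∷_))) + (sumVecs {n} (f ∘ (true ∷_)) + sumVecs {n} (g ∘ (true ∷_)))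
    ≡⟨ interchange (sumVecs {n} _) (sumVecs {n} _) (sumVecs {n} _) (sumVecs {n} _) ⟩
  sumVecs f + sumVecs g
    ∎

sumVecs-++ : (m : ℕ) {k : ℕ} (h : Vec Bool (m + k) → ℕ) →
             sumVecs h ≡ sumVecs {m} (λ v → sumVecs {k} (λ t → h (v ++ t)))
sumVecs-++ zero    h = refl
sumVecs-++ (suc m) {k} h = cong₂ _+_ (sumVecs-++ m {k} (h ∘ (false ∷_))) (sumVecs-++ m {k} (h ∘ (true ∷_)))

length-filter-map : {A B : Set} (P : B → Bool) (f : A → B) (xs : List A) →
                    length (filter (λ y → P y ≟ true) (map f xs)) ≡ length (filter (λ x → P (f x) ≟ true) xs)
length-filter-map P f []       = refl
length-filter-map P f (x ∷ xs) with P (f x)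
... | true  = cong suc (length-filter-map P f xs)
... | false = length-filter-map P f xs

length-filter-allVecs : (n : ℕ) (P : Vec Bool n → Bool) →
                        length (filter (λ v → P v ≟ true) (allVecs n)) ≡ sumVecs (ind ∘ P)
length-filter-allVecs zero P with P []
... | true  = refl
... | false = refl
length-filter-allVecs (suc n) P = begin
  length (filter P? (map (false ∷_) (allVecs n) ++ₗ map (true ∷_) (allVecs n)))
    ≡⟨ cong length (Listₚ.filter-++ P? (map (false ∷_) (allVecs n)) _) ⟩
  length (filter P? (map (false ∷_) (allVecs n)) ++ₗ filter P? (map (true ∷_) (allVecs n)))
    ≡⟨ Listₚ.length-++ (filter P? (map (false ∷_) (allVecs n))) ⟩
  length (filter P? (map (false ∷_) (allVecs n))) + length (filter P? (map (true ∷_) (allVecs n)))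
    ≡⟨ cong₂ _+_ (trans (length-filter-map P (false ∷_) (allVecs n)) (length-filter-allVecs n _))
                 (trans (length-filter-map P (true ∷_) (allVecs n)) (length-filter-allVecs n _)) ⟩
  sumVecs (ind ∘ P)
    ∎
  where
  P? : (v : Vec Bool (suc n)) → Dec (P v ≡ true)
  P? v = P v ≟ true

-- The mask is put first so that, once it is known, most summands reduce by computation.
countZeroOn-sumVecs : {n : ℕ} (S : BSet n) (X : Vec Bool n) →
                      countZeroOn S X ≡ sumVecs (λ v → ind (zeroOn X v ∧ S v))
countZeroOn-sumVecs {n} S X = begin
  countZeroOn S X                           ≡⟨ length-filter-allVecs n (λ v → S v ∧ zeroOn X v) ⟩
  sumVecs (λ v → ind (S v ∧ zeroOn X v))    ≡⟨ sumVecs-cong (λ v → cong ind (∧-comm (S v) (zeroOn X v))) ⟩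
  sumVecs (λ v → ind (zeroOn X v ∧ S v))    ∎

countZeroOn-cong : {n : ℕ} {S T : BSet n} → (∀ v → S v ≡ T v) → (X : Vec Bool n) →
                   countZeroOn S X ≡ countZeroOn T X
countZeroOn-cong {S = S} {T} S≡T X = begin
  countZeroOn S X                           ≡⟨ countZeroOn-sumVecs S X ⟩
  sumVecs (λ v → ind (zeroOn X v ∧ S v))    ≡⟨ sumVecs-cong (λ v → cong (ind ∘ (zeroOn X v ∧_)) (S≡T v)) ⟩
  sumVecs (λ v → ind (zeroOn X v ∧ T v))    ≡⟨ countZeroOn-sumVecs T X ⟨
  countZeroOn T X                           ∎

countZeroOn-empty : {n : ℕ} {S : BSet n} → (∀ v → S v ≡ false) → (X : Vec Bool n) → countZeroOn S X ≡ 0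
countZeroOn-empty {n} {S} S≡∅ X = begin
  countZeroOn S X                           ≡⟨ countZeroOn-sumVecs S X ⟩
  sumVecs (λ v → ind (zeroOn X v ∧ S v))    ≡⟨ sumVecs-cong (λ v → cong (ind ∘ (zeroOn X v ∧_)) (S≡∅ v)) ⟩
  sumVecs (λ v → ind (zeroOn X v ∧ false))  ≡⟨ sumVecs-cong (λ v → cong ind (∧-zeroʳ (zeroOn X v))) ⟩
  sumVecs {n} (λ _ → 0)                     ≡⟨ sumVecs-0 n ⟩
  0                                         ∎

countZeroOn-[] : (S : BSet 0) → countZeroOn S [] ≡ ind (S [])
countZeroOn-[] S = countZeroOn-sumVecs S []

countZeroOn-∷-false : {n : ℕ} (S : BSet (suc n)) (X : Vec Bool n) →
                      countZeroOn S (false ∷ X) ≡ countZeroOn (S ∘ (false ∷_)) X + countZeroOn (S ∘ (true ∷_)) X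
countZeroOn-∷-false S X = begin
  countZeroOn S (false ∷ X)
    ≡⟨ countZeroOn-sumVecs S (false ∷ X) ⟩
  sumVecs (λ v → ind (zeroOn X v ∧ S (false ∷ v))) + sumVecs (λ v → ind (zeroOn X v ∧ S (true ∷ v)))
    ≡⟨ cong₂ _+_ (countZeroOn-sumVecs (S ∘ (false ∷_)) X) (countZeroOn-sumVecs (S ∘ (true ∷_)) X) ⟨
  countZeroOn (S ∘ (false ∷_)) X + countZeroOn (S ∘ (true ∷_)) X
    ∎

countZeroOn-∷-true : {n : ℕ} (S : BSet (suc n)) (X : Vec Bool n) →
                     countZeroOn S (true ∷ X) ≡ countZeroOn (S ∘ (false ∷_)) X
countZeroOn-∷-true {n} S X = begin
  countZeroOn S (true ∷ X)
    ≡⟨ countZeroOn-sumVecs S (true ∷ X) ⟩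
  sumVecs (λ v → ind (zeroOn X v ∧ S (false ∷ v))) + sumVecs {n} (λ _ → 0)
    ≡⟨ cong (sumVecs (λ v → ind (zeroOn X v ∧ S (false ∷ v))) +_) (sumVecs-0 n) ⟩
  sumVecs (λ v → ind (zeroOn X v ∧ S (false ∷ v))) + 0
    ≡⟨ +-identityʳ _ ⟩
  sumVecs (λ v → ind (zeroOn X v ∧ S (false ∷ v)))
    ≡⟨ countZeroOn-sumVecs (S ∘ (false ∷_)) X ⟨
  countZeroOn (S ∘ (false ∷_)) X
    ∎

powerOfTwo-double : {m : ℕ} → IsPowerOfTwo m → IsPowerOfTwo (m + m)
powerOfTwo-double (k , refl) = suc k , cong (2 ^ k +_) (sym (+-identityʳ (2 ^ k)))

ind-powerOfTwo : {b : Bool} → IsPowerOfTwo (ind b) → b ≡ true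
ind-powerOfTwo {true}  _          = refl
ind-powerOfTwo {false} (k , 0≡2^k) with () ← m^n≡0⇒m≡0 2 k (sym 0≡2^k)

powerful-full : {n : ℕ} → Powerful {n} (λ _ → true)
powerful-full []          = 0 , countZeroOn-[] (λ _ → true)
powerful-full (true ∷ X)  = subst IsPowerOfTwo (sym (countZeroOn-∷-true _ X)) (powerful-full X)
powerful-full (false ∷ X) = subst IsPowerOfTwo (sym (countZeroOn-∷-false _ X)) (powerOfTwo-double (powerful-full X))

countZeroOn-allMarked : {n : ℕ} (S : BSet n) → countZeroOn S (replicate n true) ≡ ind (S (zeros n))
countZeroOn-allMarked {zero}  S = countZeroOn-[] S
countZeroOn-allMarked {suc n} S = trans (countZeroOn-∷-true S _) (countZeroOn-allMarked (S ∘ (false ∷_)))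

powerful⇒zeros∈ : {n : ℕ} {S : BSet n} → Powerful S → S (zeros n) ≡ true
powerful⇒zeros∈ {n} {S} P = ind-powerOfTwo (subst IsPowerOfTwo (countZeroOn-allMarked S) (P (replicate n true)))

countZeroOn-∩zeros : {n : ℕ} (S : BSet n) (X : Vec Bool n) →
                     countZeroOn (λ v → isZeroVec v ∧ S v) X ≡ ind (S (zeros n))
countZeroOn-∩zeros S []          = countZeroOn-[] (λ v → isZeroVec v ∧ S v)
countZeroOn-∩zeros S (true ∷ X)  = trans (countZeroOn-∷-true _ X) (countZeroOn-∩zeros (S ∘ (false ∷_)) X)
countZeroOn-∩zeros S (false ∷ X) = begin
  countZeroOn (λ v → isZeroVec v ∧ S v) (false ∷ X)
    ≡⟨ countZeroOn-∷-false _ X ⟩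
  countZeroOn (λ v → isZeroVec v ∧ S (false ∷ v)) X + countZeroOn (λ _ → false) X
    ≡⟨ cong₂ _+_ (countZeroOn-∩zeros (S ∘ (false ∷_)) X) (countZeroOn-empty (λ _ → refl) X) ⟩
  ind (S (zeros (suc _))) + 0
    ≡⟨ +-identityʳ _ ⟩
  ind (S (zeros (suc _)))
    ∎

isZeroVec⇒≡zeros : {n : ℕ} (v : Vec Bool n) → isZeroVec v ≡ true → v ≡ zeros n
isZeroVec⇒≡zeros []          _    = refl
isZeroVec⇒≡zeros (false ∷ v) v≡0 = cong (false ∷_) (isZeroVec⇒≡zeros v v≡0)

ind-∧-split : ∀ y z s → (z ≡ true → s ≡ true) → ind (y ∧ z) + ind (y ∧ (s ∧ not z)) ≡ ind (y ∧ s)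
ind-∧-split false z     s     _   = refl
ind-∧-split true  true  s     z⇒s rewrite z⇒s refl = refl
ind-∧-split true  false s     _   = cong ind (∧-identityʳ s)

countZeroOn-zeros+nonzero : {n : ℕ} {S : BSet n} → S (zeros n) ≡ true → (X : Vec Bool n) →
                            countZeroOn isZeroVec X + countZeroOn (λ v → S v ∧ not (isZeroVec v)) X ≡ countZeroOn S X
countZeroOn-zeros+nonzero {n} {S} 0∈S X = begin
  countZeroOn isZeroVec X + countZeroOn (λ v → S v ∧ not (isZeroVec v)) X
    ≡⟨ cong₂ _+_ (countZeroOn-sumVecs isZeroVec X) (countZeroOn-sumVecs _ X) ⟩
  sumVecs (λ v → ind (zeroOn X v ∧ isZeroVec v)) + sumVecs (λ v → ind (zeroOn X v ∧ (S v ∧ not (isZeroVec v))))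
    ≡⟨ sumVecs-+ {n} _ _ ⟨
  sumVecs (λ v → ind (zeroOn X v ∧ isZeroVec v) + ind (zeroOn X v ∧ (S v ∧ not (isZeroVec v))))
    ≡⟨ sumVecs-cong (λ v → ind-∧-split (zeroOn X v) (isZeroVec v) (S v) (zero∈ v)) ⟩
  sumVecs (λ v → ind (zeroOn X v ∧ S v))
    ≡⟨ countZeroOn-sumVecs S X ⟨
  countZeroOn S X
    ∎
  where
  zero∈ : ∀ v → isZeroVec v ≡ true → S v ≡ true
  zero∈ v v≡0 = subst (λ u → S u ≡ true) (sym (isZeroVec⇒≡zeros v v≡0)) 0∈S

countZeroOn-∷-inHyperplane : {n : ℕ} {S : BSet (suc n)} → (∀ v → S (true ∷ v) ≡ false) →
                             (c : Bool) (X : Vec Bool n) → countZeroOn S (c ∷ X) ≡ countZeroOn (S ∘ (false ∷_)) X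
countZeroOn-∷-inHyperplane {S = S} _ true X = countZeroOn-∷-true S X
countZeroOn-∷-inHyperplane {S = S} S≡∅ false X = begin
  countZeroOn S (false ∷ X)
    ≡⟨ countZeroOn-∷-false S X ⟩
  countZeroOn (S ∘ (false ∷_)) X + countZeroOn (S ∘ (true ∷_)) X
    ≡⟨ cong (countZeroOn (S ∘ (false ∷_)) X +_) (countZeroOn-empty S≡∅ X) ⟩
  countZeroOn (S ∘ (false ∷_)) X + 0
    ≡⟨ +-identityʳ _ ⟩
  countZeroOn (S ∘ (false ∷_)) X
    ∎

-- The word w = v c ∈ F₂^{n+1} of the construction is represented by c ∷ v.
setA : {n : ℕ} → BSet n → BSet (suc n)
setA S₁ (c ∷ v) = inA S₁ v c

setB : {n : ℕ} → BSet n → BSet (suc n)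
setB S₂ (c ∷ v) = inB S₂ v c

powerful-setA : {n : ℕ} {S₁ : BSet n} → Powerful S₁ → Powerful (setA S₁)
powerful-setA P₁ (c ∷ X) = subst IsPowerOfTwo (sym (countZeroOn-∷-inHyperplane (λ _ → refl) c X)) (P₁ X)

powerful-setB : {n : ℕ} {S₂ : BSet n} → Powerful S₂ → Powerful (setB S₂)
powerful-setB {S₂ = S₂} P₂ (true ∷ X) = 0 , (begin
  countZeroOn (setB S₂) (true ∷ X)                   ≡⟨ countZeroOn-∷-true (setB S₂) X ⟩
  countZeroOn isZeroVec X                            ≡⟨ countZeroOn-cong (λ v → sym (∧-identityʳ (isZeroVec v))) X ⟩
  countZeroOn (λ v → isZeroVec v ∧ true) X           ≡⟨ countZeroOn-∩zeros (λ _ → true) X ⟩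
  1                                                  ∎)
powerful-setB {S₂ = S₂} P₂ (false ∷ X) =
  subst IsPowerOfTwo (sym (trans (countZeroOn-∷-false (setB S₂) X) (countZeroOn-zeros+nonzero (powerful⇒zeros∈ P₂) X))) (P₂ X)

powerful-setA∩setB : {n : ℕ} {S₁ : BSet n} (S₂ : BSet n) → Powerful S₁ → Powerful (λ w → setA S₁ w ∧ setB S₂ w)
powerful-setA∩setB {n} {S₁} S₂ P₁ (c ∷ X) = 0 , (begin
  countZeroOn (λ w → setA S₁ w ∧ setB S₂ w) (c ∷ X)   ≡⟨ countZeroOn-∷-inHyperplane (λ _ → refl) c X ⟩
  countZeroOn (λ v → S₁ v ∧ isZeroVec v) X            ≡⟨ countZeroOn-cong (λ v → ∧-comm (S₁ v) (isZeroVec v)) X ⟩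
  countZeroOn (λ v → isZeroVec v ∧ S₁ v) X            ≡⟨ countZeroOn-∩zeros S₁ X ⟩
  ind (S₁ (zeros n))                                  ≡⟨ cong ind (powerful⇒zeros∈ P₁) ⟩
  1                                                   ∎)

splitAt-++ : {m k : ℕ} (v : Vec Bool m) (t : Vec Bool k) → splitAt m (v ++ t) ≡ (v , t , refl)
splitAt-++ []      t = refl
splitAt-++ (b ∷ v) t rewrite splitAt-++ v t = refl

◇-++ : {n : ℕ} (S₁ S₂ : BSet n) (v : Vec Bool n) (t : Vec Bool 3) → (S₁ ◇ S₂) (v ++ t) ≡ diamondAux S₁ S₂ v t
◇-++ S₁ S₂ v t rewrite splitAt-++ v t = refl

zeroOn-++ : {m k : ℕ} (Y : Vec Bool m) (Z : Vec Bool k) (v : Vec Bool m) (t : Vec Bool k) →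
            zeroOn (Y ++ Z) (v ++ t) ≡ zeroOn Y v ∧ zeroOn Z t
zeroOn-++ []          Z []      t = refl
zeroOn-++ (true ∷ Y)  Z (b ∷ v) t = trans (cong (not b ∧_) (zeroOn-++ Y Z v t)) (sym (∧-assoc (not b) _ _))
zeroOn-++ (false ∷ Y) Z (b ∷ v) t = zeroOn-++ Y Z v t

-- Membership in A ∩ B, A, B or F₂^{n+1}, according to which of the last two coordinates of X are marked.
inAB : Bool → Bool → Bool → Bool → Bool
inAB false false _ _ = true
inAB true  false a _ = a
inAB false true  _ b = b
inAB true  true  a b = a ∧ b

-- Above each w = v c lies exactly one point of S₁ ◇ S₂, namely w [w ∉ A] [w ∉ B].
diamond-fibre : {n : ℕ} (S₁ S₂ : BSet n) (v : Vec Bool n) (c z₁ z₂ : Bool) →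
                sumVecs (λ t → ind (zeroOn (z₁ ∷ z₂ ∷ []) t ∧ diamondAux S₁ S₂ v (c ∷ t)))
                  ≡ ind (inAB z₁ z₂ (inA S₁ v c) (inB S₂ v c))
diamond-fibre S₁ S₂ v c z₁ z₂ with inA S₁ v c | inB S₂ v c | z₁ | z₂
... | true  | true  | true  | true  = refl
... | true  | true  | true  | false = refl
... | true  | true  | false | true  = refl
... | true  | true  | false | false = refl
... | true  | false | true  | true  = refl
... | true  | false | true  | false = refl
... | true  | false | false | true  = refl
... | true  | false | false | false = refl
... | false | true  | true  | true  = refl
... | false | true  | true  | false = refl
... | false | true  | false | true  = refl
... | false | true  | false | false = refl
... | false | false | true  | true  = refl
... | false | false | true  | false = refl
... | false | false | false | true  = refl
... | false | false | false | false = refl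

module _ {n : ℕ} (S₁ S₂ : BSet n) (z₁ z₂ : Bool) where

  setAB : BSet (suc n)
  setAB w = inAB z₁ z₂ (setA S₁ w) (setB S₂ w)

  diamond-column : (c₀ : Bool) (Y v : Vec Bool n) →
                   sumVecs (λ t → ind (zeroOn Y v ∧ (zeroOn (c₀ ∷ z₁ ∷ z₂ ∷ []) t ∧ diamondAux S₁ S₂ v t)))
                     ≡ ind (zeroOn (c₀ ∷ Y) (false ∷ v) ∧ setAB (false ∷ v)) + ind (zeroOn (c₀ ∷ Y) (true ∷ v) ∧ setAB (true ∷ v))
  diamond-column true Y v with zeroOn Y v
  ... | false = refl
  ... | true  = cong (_+ 0) (diamond-fibre S₁ S₂ v false z₁ z₂)
  diamond-column false Y v with zeroOn Y v
  ... | false = refl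
  ... | true  = cong₂ _+_ (diamond-fibre S₁ S₂ v false z₁ z₂) (diamond-fibre S₁ S₂ v true z₁ z₂)

  countZeroOn-◇ : (Y : Vec Bool n) (c₀ : Bool) →
                  countZeroOn (S₁ ◇ S₂) (Y ++ c₀ ∷ z₁ ∷ z₂ ∷ []) ≡ countZeroOn setAB (c₀ ∷ Y)
  countZeroOn-◇ Y c₀ = begin
    countZeroOn (S₁ ◇ S₂) (Y ++ Z)
      ≡⟨ countZeroOn-sumVecs (S₁ ◇ S₂) (Y ++ Z) ⟩
    sumVecs (λ u → ind (zeroOn (Y ++ Z) u ∧ (S₁ ◇ S₂) u))
      ≡⟨ sumVecs-++ n _ ⟩
    sumVecs {n} (λ v → sumVecs {3} (λ t → ind (zeroOn (Y ++ Z) (v ++ t) ∧ (S₁ ◇ S₂) (v ++ t))))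
      ≡⟨ sumVecs-cong {n} (λ v → sumVecs-cong {3} (λ t → cong ind (split v t))) ⟩
    sumVecs (λ v → sumVecs (λ t → ind (zeroOn Y v ∧ (zeroOn Z t ∧ diamondAux S₁ S₂ v t))))
      ≡⟨ sumVecs-cong (diamond-column c₀ Y) ⟩
    sumVecs (λ v → ind (zeroOn (c₀ ∷ Y) (false ∷ v) ∧ setAB (false ∷ v)) + ind (zeroOn (c₀ ∷ Y) (true ∷ v) ∧ setAB (true ∷ v)))
      ≡⟨ sumVecs-+ {n} _ _ ⟩
    sumVecs (λ w → ind (zeroOn (c₀ ∷ Y) w ∧ setAB w))
      ≡⟨ countZeroOn-sumVecs setAB (c₀ ∷ Y) ⟨
    countZeroOn setAB (c₀ ∷ Y)
      ∎
    where
    Z : Vec Bool 3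
    Z = c₀ ∷ z₁ ∷ z₂ ∷ []
    split : ∀ v t → zeroOn (Y ++ Z) (v ++ t) ∧ (S₁ ◇ S₂) (v ++ t) ≡ zeroOn Y v ∧ (zeroOn Z t ∧ diamondAux S₁ S₂ v t)
    split v t = begin
      zeroOn (Y ++ Z) (v ++ t) ∧ (S₁ ◇ S₂) (v ++ t)
        ≡⟨ cong₂ _∧_ (zeroOn-++ Y Z v t) (◇-++ S₁ S₂ v t) ⟩
      (zeroOn Y v ∧ zeroOn Z t) ∧ diamondAux S₁ S₂ v t
        ≡⟨ ∧-assoc (zeroOn Y v) _ _ ⟩
      zeroOn Y v ∧ (zeroOn Z t ∧ diamondAux S₁ S₂ v t)
        ∎

powerful-setAB : {n : ℕ} {S₁ S₂ : BSet n} → Powerful S₁ → Powerful S₂ → ∀ z₁ z₂ → Powerful (setAB S₁ S₂ z₁ z₂)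
powerful-setAB P₁ P₂ false false = powerful-full
powerful-setAB P₁ P₂ true  false = powerful-setA P₁
powerful-setAB P₁ P₂ false true  = powerful-setB P₂
powerful-setAB {S₂ = S₂} P₁ P₂ true true = powerful-setA∩setB S₂ P₁

theorem13 : (n : ℕ) (S₁ S₂ : BSet n) → Powerful S₁ → Powerful S₂ → Powerful (S₁ ◇ S₂)
theorem13 n S₁ S₂ P₁ P₂ X with splitAt n X
... | Y , c₀ ∷ z₁ ∷ z₂ ∷ [] , refl =
  subst IsPowerOfTwo (sym (countZeroOn-◇ S₁ S₂ z₁ z₂ Y c₀)) (powerful-setAB P₁ P₂ z₁ z₂ (c₀ ∷ Y))
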